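{- Let $\ell\ge1$ and let $x$ be a product of two $\ell$-bit primes. The formula obtained from the straightforward test circuit — which multiplies two $\ell$-bit inputs $u,v$ by schoolbook multiplication (using $\ell^2$ AND gates and $\ell-1$ adders of two $\ell$-bit numbers) and then checks with $2\ell-1$ further gates whether the product equals $x$ — via the standard gate-by-gate circuit-to-formula reduction, has $3\ell^2+2\ell-1$ variables, at most this number of clauses in extended 4-conjunctive form, and at most $20\ell^2-8\ell-4$ clauses in 4-conjunctive normal form. Its variables include $2\ell$ variables encoding $u,v$, and an assignment to these extends to a satisfying assignment if and only if $u\cdot v=x$.
   Context: An $\ell$-bit number is an integer in $\{0,\dots,2^\ell-1\}$; an $\ell$-bit prime is a prime that is an $\ell$-bit number with leading bit 1. Circuit gates have fan-in 2 or 3 and compute arbitrary Boolean functions; an adder of two $\ell$-bit numbers uses $2\ell$ gates of fan-in 3. The standard reduction introduces one variable per input and one variable per gate, and one clause per gate expressing that the gate variable equals the gate's function of its input variables (with the output forced to 1); a formula in extended 4-conjunctive form is a conjunction of such clauses, each an arbitrary Boolean constraint on at most 4 variables; a fan-in-2 gate clause becomes at most 4 ordinary clauses and a fan-in-3 gate clause at most 8 ordinary clauses in 4-conjunctive normal form. -}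

module Defs where

open import Data.Nat using (ℕ; zero; suc; _+_; _*_; _∸_; _^_; _≤_; _<_; _≡ᵇ_)
open import Data.Nat.DivMod using (_/_; _%_)
open import Data.Nat.Primality using (Prime)
open import Data.Bool using (Bool; true; false; _∧_; _∨_; not; _xor_; if_then_else_)
open import Data.Maybe using (Maybe; just; nothing)
open import Data.List using (List; []; _∷_; _++_; map; concatMap; upTo; length; zip)
open import Data.List.Relation.Unary.All using (All)
open import Data.List.Relation.Unary.Any using (Any)
open import Data.Vec using (Vec; []; _∷_; zipWith; toList; fromList)
import Data.Vec as V
open import Data.Product using (_×_; _,_; proj₁; proj₂)
open import Relation.Binary.PropositionalEquality using (_≡_)

bit : ℕ → ℕ → Bool
bit x zero    = x % 2 ≡ᵇ 1
bit x (suc k) = bit (x / 2) k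

BitPrime : ℕ → ℕ → Set
BitPrime ℓ p = Prime p × (2 ^ (ℓ ∸ 1) ≤ p) × (p < 2 ^ ℓ)

-- Variables/wires are natural numbers: a circuit with numIn
-- inputs has input wires 0 … numIn-1, and gate number j (in list order)
-- is wire numIn + j.  Each gate may only read earlier wires.  The output
-- of the circuit is the last gate.

record Gate : Set where
  constructor gate
  field
    arity : ℕ
    ins   : Vec ℕ arity
    fn    : Vec Bool arity → Bool
open Gate public

record Circuit : Set where
  constructor circuit
  field
    numIn : ℕ
    gates : List Gate
open Circuit public

numVars : Circuit → ℕ
numVars C = numIn C + length (gates C)

-- Formulas in extended 4-conjunctive form: conjunctions of arbitrary
-- Boolean constraints on (a vector of) variables.

record Constraint : Set where
  constructor constraint
  field
    carity : ℕ
    cvars  : Vec ℕ carity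
    rel    : Vec Bool carity → Bool
open Constraint public

Assignment : Set
Assignment = ℕ → Bool

SatExt : Assignment → List Constraint → Set
SatExt σ F = All (λ c → rel c (V.map σ (cvars c)) ≡ true) F

Literal : Set
Literal = ℕ × Bool

Clause : Set
Clause = List Literal

SatCNF : Assignment → List Clause → Set
SatCNF σ F = All (λ cl → Any (λ lit → σ (proj₁ lit) ≡ proj₂ lit) cl) F

gateConstraint : Bool → ℕ → Gate → Constraint
gateConstraint isOut z (gate k xs f) =
  constraint (suc k) (z ∷ xs)
    (λ { (b ∷ bs) → if isOut then b ∧ f bs else not (b xor f bs) })

gatesExt : ℕ → List Gate → List Constraint
gatesExt z []             = []
gatesExt z (g ∷ [])       = gateConstraint true z g ∷ []
gatesExt z (g ∷ g' ∷ gs)  = gateConstraint false z g ∷ gatesExt (suc z) (g' ∷ gs)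

toExt : Circuit → List Constraint
toExt C = gatesExt (numIn C) (gates C)

allAssign : (k : ℕ) → List (Vec Bool k)
allAssign zero    = [] ∷ []
allAssign (suc k) = concatMap (λ v → (false ∷ v) ∷ (true ∷ v) ∷ []) (allAssign k)

-- 4-CNF translation of a gate clause: for every assignment α of the
-- gate inputs one clause "xs ≠ α  ∨  z = f(α)"; for the output gate
-- (forced to 1) the literal on z is dropped when f(α) = 0 and is
-- the positive literal z otherwise.  (2^fan-in clauses per gate.)
gateClauses : Bool → ℕ → Gate → List Clause
gateClauses isOut z (gate k xs f) =
  map (λ α → toList (zipWith (λ i a → (i , not a)) xs α)
             ++ (if isOut ∧ not (f α) then [] else (z , f α) ∷ []))
      (allAssign k)

gatesCNF : ℕ → List Gate → List Clause
gatesCNF z []             = []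
gatesCNF z (g ∷ [])       = gateClauses true z g
gatesCNF z (g ∷ g' ∷ gs)  = gateClauses false z g ++ gatesCNF (suc z) (g' ∷ gs)

toCNF : Circuit → List Clause
toCNF C = gatesCNF (numIn C) (gates C)

-- A source is either a wire or the constant 0 (nothing).  A gate with
-- some constant-0 inputs is built with those inputs hard-wired into its
-- function (so its fan-in is the number of real wires).

Src : Set
Src = Maybe ℕ

wiresOf : List Src → List ℕ
wiresOf []             = []
wiresOf (nothing ∷ ss) = wiresOf ss
wiresOf (just w ∷ ss)  = w ∷ wiresOf ss

fill : List Src → List Bool → List Bool
fill []             bs       = []
fill (nothing ∷ ss) bs       = false ∷ fill ss bs
fill (just _ ∷ ss)  []       = false ∷ fill ss []
fill (just _ ∷ ss)  (b ∷ bs) = b ∷ fill ss bs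

mkGate : List Src → (List Bool → Bool) → Gate
mkGate ss f = gate (length (wiresOf ss)) (fromList (wiresOf ss))
                   (λ bs → f (fill ss (toList bs)))

xor3 : List Bool → Bool
xor3 (a ∷ b ∷ c ∷ _) = a xor b xor c
xor3 _               = false

maj3 : List Bool → Bool
maj3 (a ∷ b ∷ c ∷ _) = (a ∧ b) ∨ (a ∧ c) ∨ (b ∧ c)
maj3 _               = false

-- ripple-carry adder: 2 gates (sum, carry) per bit position, fan-in 3;
-- first free wire n, incoming carry c; returns gates and the
-- (length + 1) output bits, least significant first.
ripple : ℕ → Src → List (Src × Src) → List Gate × List Src
ripple n c [] = [] , c ∷ []
ripple n c ((a , b) ∷ ps) with ripple (suc (suc n)) (just (suc n)) ps
... | gs , out = mkGate (a ∷ b ∷ c ∷ []) xor3 ∷ mkGate (a ∷ b ∷ c ∷ []) maj3 ∷ gs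
               , just n ∷ out

-- wires u_i (i < ℓ) are 0 … ℓ-1, v_j are ℓ … 2ℓ-1 (least significant first)
andGate : ℕ → ℕ → Gate
andGate i w = gate 2 (i ∷ w ∷ []) (λ { (a ∷ b ∷ []) → a ∧ b })

-- the ℓ² AND gates: partial product u_i ∧ v_j is wire 2ℓ + ℓ j + i
andGates : ℕ → List Gate
andGates ℓ = concatMap (λ j → map (λ i → andGate i (ℓ + j)) (upTo ℓ)) (upTo ℓ)

row : ℕ → ℕ → List Src
row ℓ j = map (λ i → just (2 * ℓ + ℓ * j + i)) (upTo ℓ)

-- schoolbook accumulation: acc holds ℓ+1 bits; at step j the lowest bit is
-- final, the remaining ℓ bits are added to row j by an adder of two ℓ-bit
-- numbers.
steps : ℕ → ℕ → List ℕ → List Src → List Gate × List Src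
steps ℓ n []       acc        = [] , acc
steps ℓ n (j ∷ js) []         = [] , []
steps ℓ n (j ∷ js) (a0 ∷ up) with ripple n nothing (zip up (row ℓ j))
... | g1 , out1 with steps ℓ (n + length g1) js out1
...   | g2 , bits = g1 ++ g2 , a0 ∷ bits

eqb : Bool → Bool → Bool
eqb a b = not (a xor b)

chain : ℕ → ℕ → ℕ → List Src → List Gate
chain x prev k []       = []
chain x prev k (s ∷ ss) =
  mkGate (just prev ∷ s ∷ []) (λ { (a ∷ b ∷ _) → a ∧ eqb b (bit x k) ; _ → false })
  ∷ chain x (suc prev) (suc k) ss

check : ℕ → ℕ → List Src → List Gate
check n x (s0 ∷ s1 ∷ rest) =
  mkGate (s0 ∷ s1 ∷ []) (λ { (a ∷ b ∷ _) → eqb a (bit x 0) ∧ eqb b (bit x 1) ; _ → false })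
  ∷ chain x n 2 rest
check n x _ = []

testCircuit : ℕ → ℕ → Circuit
testCircuit ℓ x with steps ℓ (2 * ℓ + ℓ * ℓ) (map suc (upTo (ℓ ∸ 1))) (row ℓ 0 ++ nothing ∷ [])
... | addGs , bits =
  circuit (2 * ℓ)
    (andGates ℓ ++ addGs ++ check (2 * ℓ + ℓ * ℓ + length addGs) x bits)

Encodes : ℕ → Assignment → ℕ → ℕ → Set
Encodes ℓ σ u v = (∀ i → i < ℓ → σ i ≡ bit u i) × (∀ i → i < ℓ → σ (ℓ + i) ≡ bit v i)

-- Each gate of a circuit becomes one constraint "z = f(inputs)", or 2^fan-in clauses
-- "inputs ≠ α ∨ z = f(α)", and either form holds exactly when the gate variable carries the gate's
-- value (and, for the output gate, is 1).  Every gate reads only earlier wires, so any assignment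
-- of the inputs extends, by evaluating the gates in order, to one consistent with all gates: the
-- formula is satisfiable above an input assignment iff the circuit accepts that input.
-- In the test circuit the AND gates produce the rows u·v_j, and each ripple-carry adder adds the
-- next row to the running sum by the full-adder identity s + 2c = a + b + c_in, so the 2ℓ product
-- bits spell u·v in binary; the comparison chain outputs 1 iff they are the binary digits of
-- x < 2^(2ℓ).  The counts come from ℓ² AND gates of fan-in 2, 2ℓ(ℓ-1) adder gates of fan-in 3 and
-- 2ℓ-1 comparison gates of fan-in 2, each giving 2^fan-in clauses.
module Submission where

open import Defs
open import Data.Bool using (Bool; true; false; _∧_; not; if_then_else_)
open import Data.Bool.Properties using (∧-assoc; ∧-identityʳ; ¬-not; not-¬)
  renaming (_≟_ to _≟ᵇ_)
open import Data.List using (List; []; _∷_; _++_; map; concatMap; applyUpTo; upTo; length; zip)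
import Data.List.Properties as List
open import Data.List.Relation.Unary.All as All using (All; []; _∷_)
open import Data.List.Relation.Unary.All.Properties
  using (++⁺; ++⁻; map⁺; map⁻; concat⁺; applyUpTo⁺₁)
open import Data.List.Relation.Unary.Any as Any using (Any; here; there)
import Data.List.Relation.Unary.Any.Properties as Any
open import Data.List.Membership.Propositional using (_∈_)
open import Data.List.Membership.Propositional.Properties using (∈-concatMap⁺)
open import Data.Maybe using (just; nothing)
import Data.Maybe.Relation.Unary.All as Maybe
open import Data.Nat
  using (ℕ; zero; suc; _+_; _*_; _∸_; _^_; _≤_; _<_; _≡ᵇ_; _⊓_; z≤n; s≤s; z<s; _<?_)
open import Data.Nat.Properties
open import Data.Nat.ListAction using (sum)
open import Data.Nat.ListAction.Properties using (sum-++)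
open import Data.Nat.DivMod
  using (_/_; _%_; m≡m%n+[m/n]*n; m%n<n; [m+kn]%n≡m%n; m<n*o⇒m/o<n)
open import Data.Nat.Solver using (module +-*-Solver)
open import Data.Product using (_×_; _,_; proj₁; proj₂; ∃; ∃₂)
import Data.Product as Product
open import Data.Sum using (inj₁; inj₂)
open import Data.Unit using (⊤; tt)
open import Data.Vec using (Vec; []; _∷_; zipWith; toList; fromList)
import Data.Vec as Vec
import Data.Vec.Properties as Vec
import Data.Vec.Relation.Unary.All as VA
open import Function.Base using (_∘_; id; case_of_)
open import Function.Bundles using (_⇔_; mk⇔; module Equivalence)
import Function.Properties.Equivalence as ⇔
import Function.Related.Propositional as Related
open import Relation.Binary.PropositionalEquality
open import Relation.Nullary using (yes; no; contradiction)

open Equivalence using (to; from)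
open +-*-Solver using (solve; _:=_; _:+_; _:*_; _:^_; con)

≡⇒⇔ : ∀ {A : Set} (P : A → Set) {a b : A} → a ≡ b → P a ⇔ P b
≡⇒⇔ P refl = ⇔.refl

-- Circuit semantics

Agree : ℕ → Assignment → Assignment → Set
Agree n σ τ = ∀ {w} → w < n → σ w ≡ τ w

evalGate : Assignment → Gate → Bool
evalGate σ g = fn g (Vec.map σ (ins g))

Consistent : Assignment → ℕ → List Gate → Set
Consistent σ n []       = ⊤
Consistent σ n (g ∷ gs) = σ n ≡ evalGate σ g × Consistent σ (suc n) gs

OutputTrue : Assignment → ℕ → List Gate → Set
OutputTrue σ n []            = ⊤
OutputTrue σ n (g ∷ [])      = σ n ≡ true
OutputTrue σ n (g ∷ g′ ∷ gs) = OutputTrue σ (suc n) (g′ ∷ gs)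

Accepts : Assignment → ℕ → List Gate → Set
Accepts σ n gs = Consistent σ n gs × OutputTrue σ n gs

ReadsEarlier : ℕ → List Gate → Set
ReadsEarlier n []       = ⊤
ReadsEarlier n (g ∷ gs) = VA.All (_< n) (ins g) × ReadsEarlier (suc n) gs

FanIn≤ : ℕ → List Gate → Set
FanIn≤ a = All (λ g → arity g ≤ a)

FanIn-mono : ∀ {a b} → a ≤ b → ∀ {gs} → FanIn≤ a gs → FanIn≤ b gs
FanIn-mono a≤b = All.map (λ ar≤a → ≤-trans ar≤a a≤b)

Consistent-++ : ∀ σ {n k} xs {ys} → n + length xs ≡ k →
                Consistent σ n (xs ++ ys) → Consistent σ n xs × Consistent σ k ys
Consistent-++ σ {n} []       {ys} eq c       =
  tt , subst (λ i → Consistent σ i ys) (trans (sym (+-identityʳ n)) eq) c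
Consistent-++ σ {n} (x ∷ xs)      eq (e , c) =
  Product.map₁ (e ,_) (Consistent-++ σ xs (trans (sym (+-suc n (length xs))) eq) c)

Consistent-concatMap : ∀ σ {A : Set} (F : A → List Gate) {L} → (∀ a → length (F a) ≡ L) →
  ∀ f m {n} → Consistent σ n (concatMap F (applyUpTo f m)) →
  ∀ {j} → j < m → Consistent σ (n + L * j) (F (f j))
Consistent-concatMap σ F {L} len f (suc m) {n} c {zero}  _ =
  subst (λ k → Consistent σ k (F (f 0))) (sym (trans (cong (n +_) (*-zeroʳ L)) (+-identityʳ n)))
        (proj₁ (Consistent-++ σ (F (f 0)) refl c))
Consistent-concatMap σ F {L} len f (suc m) {n} c {suc j} (s≤s j<m) =
  subst (λ k → Consistent σ k (F (f (suc j)))) (trans (+-assoc n L (L * j)) (cong (n +_) (sym (*-suc L j))))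
        (Consistent-concatMap σ F len (f ∘ suc) m rest j<m)
  where rest = proj₂ (Consistent-++ σ (F (f 0)) (cong (n +_) (len (f 0))) c)

Consistent-map : ∀ σ (G : ℕ → Gate) f m {n} → Consistent σ n (map G (applyUpTo f m)) →
                 ∀ {i} → i < m → σ (n + i) ≡ evalGate σ (G (f i))
Consistent-map σ G f (suc m) {n} (e , _) {zero}  _         = trans (cong σ (+-identityʳ n)) e
Consistent-map σ G f (suc m) {n} (_ , c) {suc i} (s≤s i<m) =
  trans (cong σ (+-suc n i)) (Consistent-map σ G (f ∘ suc) m c i<m)

ReadsEarlier-++ : ∀ {n k} xs {ys} → n + length xs ≡ k →
                  ReadsEarlier n xs → ReadsEarlier k ys → ReadsEarlier n (xs ++ ys)
ReadsEarlier-++ {n} []       {ys} eq _ r′ =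
  subst (λ i → ReadsEarlier i ys) (trans (sym eq) (+-identityʳ n)) r′
ReadsEarlier-++ {n} (x ∷ xs)      eq (p , r) r′ =
  p , ReadsEarlier-++ xs (trans (sym (+-suc n (length xs))) eq) r r′

ReadsEarlier-below : ∀ {b n} gs → b ≤ n → All (λ g → VA.All (_< b) (ins g)) gs → ReadsEarlier n gs
ReadsEarlier-below []       _   []       = tt
ReadsEarlier-below (g ∷ gs) b≤n (p ∷ ps) =
  VA.map (λ w<b → <-≤-trans w<b b≤n) p , ReadsEarlier-below gs (m≤n⇒m≤1+n b≤n) ps

OutputTrue-++ : ∀ σ {n k} xs {ys} → 0 < length ys → n + length xs ≡ k →
                OutputTrue σ n (xs ++ ys) ⇔ OutputTrue σ k ys
OutputTrue-++ σ {n} []            {y ∷ ys} _  eq =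
  ≡⇒⇔ (λ i → OutputTrue σ i (y ∷ ys)) (trans (sym (+-identityʳ n)) eq)
OutputTrue-++ σ {n} (x ∷ [])      {y ∷ ys} _  eq =
  ≡⇒⇔ (λ i → OutputTrue σ i (y ∷ ys)) (trans (+-comm 1 n) eq)
OutputTrue-++ σ {n} (x ∷ x′ ∷ xs)          ne eq =
  OutputTrue-++ σ (x′ ∷ xs) ne (trans (sym (+-suc n (length (x′ ∷ xs)))) eq)

OutputTrue-last : ∀ σ {n k} g gs → n + length gs ≡ k → OutputTrue σ n (g ∷ gs) ⇔ σ k ≡ true
OutputTrue-last σ {n} g []        eq = ≡⇒⇔ (λ i → σ i ≡ true) (trans (sym (+-identityʳ n)) eq)
OutputTrue-last σ {n} g (g′ ∷ gs) eq = OutputTrue-last σ g′ gs (trans (sym (+-suc n (length gs))) eq)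

update : Assignment → ℕ → Bool → Assignment
update σ n b w with w ≟ n
... | yes _ = b
... | no  _ = σ w

update-same : ∀ σ n b → update σ n b n ≡ b
update-same σ n b with n ≟ n
... | yes _   = refl
... | no  n≢n = contradiction refl n≢n

update-below : ∀ σ {n} b → Agree n (update σ n b) σ
update-below σ {n} b {w} w<n with w ≟ n
... | yes refl = contradiction w<n (<-irrefl refl)
... | no  _    = refl

extend : Assignment → ℕ → List Gate → Assignment
extend σ n []       = σ
extend σ n (g ∷ gs) = extend (update σ n (evalGate σ g)) (suc n) gs

extend-below : ∀ σ n gs → Agree n (extend σ n gs) σ
extend-below σ n []       w<n = refl
extend-below σ n (g ∷ gs) w<n =
  trans (extend-below _ (suc n) gs (m<n⇒m<1+n w<n)) (update-below σ _ w<n)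

evalGate-cong : ∀ {n σ τ} → Agree n σ τ → ∀ g → VA.All (_< n) (ins g) → evalGate σ g ≡ evalGate τ g
evalGate-cong {σ = σ} {τ} agree g reads = cong (fn g) (map-agree (ins g) reads)
  where
  map-agree : ∀ {k} (ws : Vec ℕ k) → VA.All (_< _) ws → Vec.map σ ws ≡ Vec.map τ ws
  map-agree []       VA.[]          = refl
  map-agree (w ∷ ws) (w< VA.∷ ws<) = cong₂ _∷_ (agree w<) (map-agree ws ws<)

extend-consistent : ∀ σ n gs → ReadsEarlier n gs → Consistent (extend σ n gs) n gs
extend-consistent σ n []       _           = tt
extend-consistent σ n (g ∷ gs) (reads , r) =
  (begin
     τ n           ≡⟨ extend-below σ′ (suc n) gs (n<1+n n) ⟩
     σ′ n          ≡⟨ update-same σ n (evalGate σ g) ⟩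
     evalGate σ g  ≡⟨ evalGate-cong σ≈τ g reads ⟩
     evalGate τ g  ∎)
  , extend-consistent σ′ (suc n) gs r
  where
  open ≡-Reasoning
  σ′ τ : Assignment
  σ′ = update σ n (evalGate σ g)
  τ  = extend σ′ (suc n) gs
  σ≈τ : Agree n σ τ
  σ≈τ w<n = sym (trans (extend-below σ′ (suc n) gs (m<n⇒m<1+n w<n)) (update-below σ _ w<n))

-- Faithfulness of the gate-by-gate reduction

GateSpec : Bool → Bool → Bool → Set
GateSpec isOut wire val = wire ≡ val × (isOut ≡ true → wire ≡ true)

eqb≡true⇔ : ∀ a b → eqb a b ≡ true ⇔ a ≡ b
eqb≡true⇔ false false = mk⇔ (λ _ → refl) (λ _ → refl)
eqb≡true⇔ false true  = mk⇔ (λ ()) (λ ())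
eqb≡true⇔ true  false = mk⇔ (λ ()) (λ ())
eqb≡true⇔ true  true  = mk⇔ (λ _ → refl) (λ _ → refl)

∧≡true⇔ : ∀ a b → a ∧ b ≡ true ⇔ (a ≡ true × b ≡ true)
∧≡true⇔ false b = mk⇔ (λ ()) (λ ())
∧≡true⇔ true  b = mk⇔ (refl ,_) proj₂

gateRel⇔ : ∀ isOut a b → (if isOut then a ∧ b else eqb a b) ≡ true ⇔ GateSpec isOut a b
gateRel⇔ false a     b     = mk⇔ (λ e → to (eqb≡true⇔ a b) e , λ ()) (from (eqb≡true⇔ a b) ∘ proj₁)
gateRel⇔ true  true  true  = mk⇔ (λ _ → refl , λ _ → refl) (λ _ → refl)
gateRel⇔ true  true  false = mk⇔ (λ ()) (λ { (() , _) })
gateRel⇔ true  false b     = mk⇔ (λ ()) (λ (_ , out) → case out refl of λ ())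

satExt⇔ : ∀ σ n gs → SatExt σ (gatesExt n gs) ⇔ Accepts σ n gs
satExt⇔ σ n gs = mk⇔ (sound n gs) (complete n gs)
  where
  sound : ∀ n gs → SatExt σ (gatesExt n gs) → Accepts σ n gs
  sound n []            _        = tt , tt
  sound n (g ∷ [])      (s ∷ []) =
    let (e , out) = to (gateRel⇔ true _ _) s in (e , tt) , out refl
  sound n (g ∷ g′ ∷ gs) (s ∷ ss) =
    let (c , out) = sound (suc n) (g′ ∷ gs) ss in (proj₁ (to (gateRel⇔ false _ _) s) , c) , out
  complete : ∀ n gs → Accepts σ n gs → SatExt σ (gatesExt n gs)
  complete n []            _               = []
  complete n (g ∷ [])      ((e , _) , out) = from (gateRel⇔ true _ _) (e , λ _ → out) ∷ []
  complete n (g ∷ g′ ∷ gs) ((e , c) , out) =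
    from (gateRel⇔ false _ _) (e , λ ()) ∷ complete (suc n) (g′ ∷ gs) (c , out)

LitHolds : Assignment → Literal → Set
LitHolds σ lit = σ (proj₁ lit) ≡ proj₂ lit

mismatch : ∀ {k} → Vec ℕ k → Vec Bool k → Clause
mismatch xs α = toList (zipWith (λ i a → (i , not a)) xs α)

outputLits : Bool → ℕ → Bool → Clause
outputLits isOut z b = if isOut ∧ not b then [] else (z , b) ∷ []

mismatch-sat⇔ : ∀ σ {k} (xs : Vec ℕ k) α → Any (LitHolds σ) (mismatch xs α) ⇔ (Vec.map σ xs ≢ α)
mismatch-sat⇔ σ []       []      = mk⇔ (λ ()) (λ ne → contradiction refl ne)
mismatch-sat⇔ σ (x ∷ xs) (a ∷ α) = mk⇔ sat⇒ ⇒sat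
  where
  sat⇒ : Any (LitHolds σ) (mismatch (x ∷ xs) (a ∷ α)) → σ x ∷ Vec.map σ xs ≢ a ∷ α
  sat⇒ (here σx≡¬a) eq = not-¬ (cong Vec.head eq) σx≡¬a
  sat⇒ (there p)    eq = to (mismatch-sat⇔ σ xs α) p (cong Vec.tail eq)
  ⇒sat : σ x ∷ Vec.map σ xs ≢ a ∷ α → Any (LitHolds σ) (mismatch (x ∷ xs) (a ∷ α))
  ⇒sat ne with σ x ≟ᵇ a
  ... | no  σx≢a = here (¬-not σx≢a)
  ... | yes σx≡a = there (from (mismatch-sat⇔ σ xs α) (λ eq → ne (cong₂ _∷_ σx≡a eq)))

outputLits-sat⇔ : ∀ σ isOut z b → Any (LitHolds σ) (outputLits isOut z b) ⇔ GateSpec isOut (σ z) b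
outputLits-sat⇔ σ false z b     = mk⇔ (λ { (here e) → e , λ () ; (there ()) }) (λ (e , _) → here e)
outputLits-sat⇔ σ true  z false = mk⇔ (λ ()) (λ (e , out) → case trans (sym e) (out refl) of λ ())
outputLits-sat⇔ σ true  z true  = mk⇔ (λ { (here e) → e , λ _ → e ; (there ()) }) (λ (e , _) → here e)

∈-allAssign : ∀ {k} (α : Vec Bool k) → α ∈ allAssign k
∈-allAssign []          = here refl
∈-allAssign (false ∷ α) = ∈-concatMap⁺ _ (Any.map (λ { refl → here refl }) (∈-allAssign α))
∈-allAssign (true  ∷ α) = ∈-concatMap⁺ _ (Any.map (λ { refl → there (here refl) }) (∈-allAssign α))

-- The clause for the actual inputs α₀ can only be satisfied by its output literals;
-- every other clause is satisfied by a mismatch literal.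
gateClauses-sat⇔ : ∀ σ isOut z g → SatCNF σ (gateClauses isOut z g) ⇔ GateSpec isOut (σ z) (evalGate σ g)
gateClauses-sat⇔ σ isOut z g = mk⇔ sat⇒ ⇒sat
  where
  clause : Vec Bool (arity g) → Clause
  clause α = mismatch (ins g) α ++ outputLits isOut z (fn g α)
  α₀ : Vec Bool (arity g)
  α₀ = Vec.map σ (ins g)
  sat⇒ : All (Any (LitHolds σ)) (map clause (allAssign (arity g))) → GateSpec isOut (σ z) (evalGate σ g)
  sat⇒ sat with Any.++⁻ (mismatch (ins g) α₀) (All.lookup (map⁻ sat) (∈-allAssign α₀))
  ... | inj₁ p = contradiction refl (to (mismatch-sat⇔ σ (ins g) α₀) p)
  ... | inj₂ p = to (outputLits-sat⇔ σ isOut z _) p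
  ⇒sat : GateSpec isOut (σ z) (evalGate σ g) → All (Any (LitHolds σ)) (map clause (allAssign (arity g)))
  ⇒sat spec = map⁺ (All.universal clause-sat (allAssign (arity g)))
    where
    clause-sat : ∀ α → Any (LitHolds σ) (clause α)
    clause-sat α with Vec.≡-dec _≟ᵇ_ α₀ α
    ... | yes refl = Any.++⁺ʳ (mismatch (ins g) α) (from (outputLits-sat⇔ σ isOut z _) spec)
    ... | no  α₀≢α = Any.++⁺ˡ (from (mismatch-sat⇔ σ (ins g) α) α₀≢α)

satCNF⇔ : ∀ σ n gs → SatCNF σ (gatesCNF n gs) ⇔ Accepts σ n gs
satCNF⇔ σ n gs = mk⇔ (sound n gs) (complete n gs)
  where
  sound : ∀ n gs → SatCNF σ (gatesCNF n gs) → Accepts σ n gs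
  sound n []            _ = tt , tt
  sound n (g ∷ [])      s =
    let (e , out) = to (gateClauses-sat⇔ σ true n g) s in (e , tt) , out refl
  sound n (g ∷ g′ ∷ gs) s =
    let (s₁ , s₂) = ++⁻ (gateClauses false n g) s
        (c , out) = sound (suc n) (g′ ∷ gs) s₂
    in (proj₁ (to (gateClauses-sat⇔ σ false n g) s₁) , c) , out
  complete : ∀ n gs → Accepts σ n gs → SatCNF σ (gatesCNF n gs)
  complete n []            _               = []
  complete n (g ∷ [])      ((e , _) , out) = from (gateClauses-sat⇔ σ true n g) (e , λ _ → out)
  complete n (g ∷ g′ ∷ gs) ((e , c) , out) =
    ++⁺ (from (gateClauses-sat⇔ σ false n g) (e , λ ())) (complete (suc n) (g′ ∷ gs) (c , out))

∃×-cong : ∀ {I A B : Assignment → Set} → (∀ σ → A σ ⇔ B σ) →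
          (∃ λ σ → I σ × A σ) ⇔ (∃ λ σ → I σ × B σ)
∃×-cong A⇔B = mk⇔ (λ (σ , i , a) → σ , i , to (A⇔B σ) a) (λ (σ , i , b) → σ , i , from (A⇔B σ) b)

-- Completeness: evaluate the gates in order on top of any assignment satisfying Input.
accepting⇔ : ∀ {n gs} (Input : Assignment → Set) {R : Set} →
  ReadsEarlier n gs →
  (∀ {σ τ} → Agree n σ τ → Input σ → Input τ) →
  ∃ Input →
  (∀ σ → Input σ → Consistent σ n gs → OutputTrue σ n gs ⇔ R) →
  (∃ λ σ → Input σ × Accepts σ n gs) ⇔ R
accepting⇔ {n} {gs} Input reads local (σ₀ , in₀) decides = mk⇔
  (λ (σ , inσ , c , out) → to (decides σ inσ c) out)
  (λ r → τ , inτ , cτ , from (decides τ inτ cτ) r)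
  where
  τ = extend σ₀ n gs
  inτ = local (λ w<n → sym (extend-below σ₀ n gs w<n)) in₀
  cτ = extend-consistent σ₀ n gs reads

reduction-faithful : ∀ C (Input : Assignment → Set) {R : Set} →
  ReadsEarlier (numIn C) (gates C) →
  (∀ {σ τ} → Agree (numIn C) σ τ → Input σ → Input τ) →
  ∃ Input →
  (∀ σ → Input σ → Consistent σ (numIn C) (gates C) → OutputTrue σ (numIn C) (gates C) ⇔ R) →
  ((∃ λ σ → Input σ × SatExt σ (toExt C)) ⇔ R) × ((∃ λ σ → Input σ × SatCNF σ (toCNF C)) ⇔ R)
reduction-faithful C Input reads local exists decides =
    ⇔.trans (∃×-cong (λ σ → satExt⇔ σ (numIn C) (gates C))) accepts
  , ⇔.trans (∃×-cong (λ σ → satCNF⇔ σ (numIn C) (gates C))) accepts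
  where accepts = accepting⇔ Input reads local exists decides

-- Size of the reduction

ConstraintWithin : ℕ → Constraint → Set
ConstraintWithin N c = carity c ≤ 4 × VA.All (_< N) (cvars c)

ClauseWithin : ℕ → Clause → Set
ClauseWithin N cl = length cl ≤ 4 × All (λ lit → proj₁ lit < N) cl

clauseCount : List Gate → ℕ
clauseCount gs = sum (map (λ g → 2 ^ arity g) gs)

length-concatMap : ∀ {A B : Set} {f : A → List B} {L} → (∀ a → length (f a) ≡ L) →
                   ∀ xs → length (concatMap f xs) ≡ length xs * L
length-concatMap         len []       = refl
length-concatMap {f = f} len (x ∷ xs) =
  trans (List.length-++ (f x)) (cong₂ _+_ (len x) (length-concatMap len xs))

length-allAssign : ∀ k → length (allAssign k) ≡ 2 ^ k
length-allAssign zero    = refl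
length-allAssign (suc k) =
  trans (length-concatMap (λ _ → refl) (allAssign k))
        (trans (*-comm (length (allAssign k)) 2) (cong (2 *_) (length-allAssign k)))

length-gatesExt : ∀ n gs → length (gatesExt n gs) ≡ length gs
length-gatesExt n []            = refl
length-gatesExt n (g ∷ [])      = refl
length-gatesExt n (g ∷ g′ ∷ gs) = cong suc (length-gatesExt (suc n) (g′ ∷ gs))

length-gateClauses : ∀ isOut z g → length (gateClauses isOut z g) ≡ 2 ^ arity g
length-gateClauses isOut z g =
  trans (List.length-map _ (allAssign (arity g))) (length-allAssign (arity g))

length-gatesCNF : ∀ n gs → length (gatesCNF n gs) ≡ clauseCount gs
length-gatesCNF n []            = refl
length-gatesCNF n (g ∷ [])      = trans (length-gateClauses true n g) (sym (+-identityʳ _))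
length-gatesCNF n (g ∷ g′ ∷ gs) =
  trans (List.length-++ (gateClauses false n g))
        (cong₂ _+_ (length-gateClauses false n g) (length-gatesCNF (suc n) (g′ ∷ gs)))

clauseCount-++ : ∀ xs ys → clauseCount (xs ++ ys) ≡ clauseCount xs + clauseCount ys
clauseCount-++ xs ys = trans (cong sum (List.map-++ _ xs ys)) (sum-++ (map _ xs) _)

clauseCount≤ : ∀ {a} gs → FanIn≤ a gs → clauseCount gs ≤ 2 ^ a * length gs
clauseCount≤ {a} []       []       = z≤n
clauseCount≤ {a} (g ∷ gs) (p ∷ ps) =
  ≤-trans (+-mono-≤ (^-monoʳ-≤ 2 p) (clauseCount≤ gs ps))
          (≤-reflexive (sym (*-suc (2 ^ a) (length gs))))

gate-bounds : ∀ {n L N} → n + suc L ≤ N → n < N × suc n + L ≤ N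
gate-bounds {n} {L} bound =
  <-≤-trans (m<m+n n z<s) bound , ≤-trans (≤-reflexive (sym (+-suc n L))) bound

gateConstraint-within : ∀ {N n} isOut g → arity g ≤ 3 → VA.All (_< n) (ins g) → n < N →
                        ConstraintWithin N (gateConstraint isOut n g)
gateConstraint-within isOut g ar reads n<N =
  s≤s ar , n<N VA.∷ VA.map (λ w<n → <-trans w<n n<N) reads

gatesExt-within : ∀ {N} n gs → ReadsEarlier n gs → FanIn≤ 3 gs → n + length gs ≤ N →
                  All (ConstraintWithin N) (gatesExt n gs)
gatesExt-within n []            _           _        _     = []
gatesExt-within n (g ∷ [])      (reads , _) (a ∷ _)  bound =
  gateConstraint-within true g a reads (proj₁ (gate-bounds bound)) ∷ []
gatesExt-within n (g ∷ g′ ∷ gs) (reads , r) (a ∷ as) bound =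
  let (n<N , bound′) = gate-bounds bound
  in gateConstraint-within false g a reads n<N ∷ gatesExt-within (suc n) (g′ ∷ gs) r as bound′

mismatch-length : ∀ {k} (xs : Vec ℕ k) α → length (mismatch xs α) ≡ k
mismatch-length xs α = Vec.length-toList (zipWith _ xs α)

mismatch-within : ∀ {N k} (xs : Vec ℕ k) α → VA.All (_< N) xs →
                  All (λ lit → proj₁ lit < N) (mismatch xs α)
mismatch-within []       []      VA.[]          = []
mismatch-within (x ∷ xs) (a ∷ α) (x< VA.∷ xs<) = x< ∷ mismatch-within xs α xs<

outputLits-within : ∀ {N} isOut z b → z < N →
                    length (outputLits isOut z b) ≤ 1 × All (λ lit → proj₁ lit < N) (outputLits isOut z b)
outputLits-within false z b     z<N = ≤-refl , z<N ∷ []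
outputLits-within true  z false z<N = z≤n , []
outputLits-within true  z true  z<N = ≤-refl , z<N ∷ []

gateClauses-within : ∀ {N n} isOut g → arity g ≤ 3 → VA.All (_< n) (ins g) → n < N →
                     All (ClauseWithin N) (gateClauses isOut n g)
gateClauses-within {N} {n} isOut g ar reads n<N =
  map⁺ (All.universal within (allAssign (arity g)))
  where
  within : ∀ α → ClauseWithin N (mismatch (ins g) α ++ outputLits isOut n (fn g α))
  within α =
    let (out≤1 , out<N) = outputLits-within isOut n (fn g α) n<N
    in ≤-trans (≤-reflexive (List.length-++ (mismatch (ins g) α)))
               (+-mono-≤ (≤-trans (≤-reflexive (mismatch-length (ins g) α)) ar) out≤1)
       , ++⁺ (mismatch-within (ins g) α (VA.map (λ w<n → <-trans w<n n<N) reads)) out<N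

gatesCNF-within : ∀ {N} n gs → ReadsEarlier n gs → FanIn≤ 3 gs → n + length gs ≤ N →
                  All (ClauseWithin N) (gatesCNF n gs)
gatesCNF-within n []            _           _        _     = []
gatesCNF-within n (g ∷ [])      (reads , _) (a ∷ _)  bound =
  gateClauses-within true g a reads (proj₁ (gate-bounds bound))
gatesCNF-within n (g ∷ g′ ∷ gs) (reads , r) (a ∷ as) bound =
  let (n<N , bound′) = gate-bounds bound
  in ++⁺ (gateClauses-within false g a reads n<N) (gatesCNF-within (suc n) (g′ ∷ gs) r as bound′)

toExt-within : ∀ C → ReadsEarlier (numIn C) (gates C) → FanIn≤ 3 (gates C) →
               All (ConstraintWithin (numVars C)) (toExt C)
toExt-within C reads fanIn = gatesExt-within (numIn C) (gates C) reads fanIn ≤-refl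

toCNF-within : ∀ C → ReadsEarlier (numIn C) (gates C) → FanIn≤ 3 (gates C) →
               All (ClauseWithin (numVars C)) (toCNF C)
toCNF-within C reads fanIn = gatesCNF-within (numIn C) (gates C) reads fanIn ≤-refl

length-toExt≤numVars : ∀ C → length (toExt C) ≤ numVars C
length-toExt≤numVars C =
  ≤-trans (≤-reflexive (length-gatesExt (numIn C) (gates C))) (m≤n+m (length (gates C)) (numIn C))

-- Binary numerals, least significant digit first

toℕ : Bool → ℕ
toℕ false = 0
toℕ true  = 1

toℕ-∧ : ∀ a b → toℕ (a ∧ b) ≡ toℕ a * toℕ b
toℕ-∧ false b     = refl
toℕ-∧ true  false = refl
toℕ-∧ true  true  = refl

fromBase2 : List ℕ → ℕ
fromBase2 []       = 0
fromBase2 (d ∷ ds) = d + 2 * fromBase2 ds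

fromBits : List Bool → ℕ
fromBits bs = fromBase2 (map toℕ bs)

fromBase2-scale : ∀ {A : Set} (f g : A → ℕ) c xs → All (λ a → f a ≡ c * g a) xs →
                  fromBase2 (map f xs) ≡ c * fromBase2 (map g xs)
fromBase2-scale f g c []       []       = sym (*-zeroʳ c)
fromBase2-scale f g c (x ∷ xs) (p ∷ ps) = begin
  f x + 2 * fromBase2 (map f xs)
    ≡⟨ cong₂ (λ d r → d + 2 * r) p (fromBase2-scale f g c xs ps) ⟩
  c * g x + 2 * (c * fromBase2 (map g xs))
    ≡⟨ solve 3 (λ c d r → c :* d :+ con 2 :* (c :* r) := c :* (d :+ con 2 :* r)) refl c (g x) _ ⟩
  c * (g x + 2 * fromBase2 (map g xs)) ∎
  where open ≡-Reasoning

toℕ-bit0 : ∀ x → toℕ (bit x 0) ≡ x % 2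
toℕ-bit0 x with x % 2 | m%n<n x 2
... | 0           | _               = refl
... | 1           | _               = refl
... | suc (suc _) | s≤s (s≤s ())

bit0-split : ∀ x → toℕ (bit x 0) + 2 * (x / 2) ≡ x
bit0-split x = trans (cong₂ _+_ (toℕ-bit0 x) (*-comm 2 (x / 2))) (sym (m≡m%n+[m/n]*n x 2))

bit0-cons : ∀ b n → bit (toℕ b + 2 * n) 0 ≡ b
bit0-cons b n = trans (cong (_≡ᵇ 1) mod2) (parity b)
  where
  mod2 : (toℕ b + 2 * n) % 2 ≡ toℕ b % 2
  mod2 = trans (cong (λ t → (toℕ b + t) % 2) (*-comm 2 n)) ([m+kn]%n≡m%n (toℕ b) n 2)
  parity : ∀ b → (toℕ b % 2 ≡ᵇ 1) ≡ b
  parity false = refl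
  parity true  = refl

half-cons : ∀ b n → (toℕ b + 2 * n) / 2 ≡ n
half-cons b n = *-cancelˡ-≡ (x / 2) n 2 (+-cancelˡ-≡ (toℕ b) _ _ (begin
  toℕ b + 2 * (x / 2)          ≡⟨ cong (λ c → toℕ c + 2 * (x / 2)) (sym (bit0-cons b n)) ⟩
  toℕ (bit x 0) + 2 * (x / 2)  ≡⟨ bit0-split x ⟩
  x                            ∎))
  where
  open ≡-Reasoning
  x = toℕ b + 2 * n

half< : ∀ x k → x < 2 ^ suc k → x / 2 < 2 ^ k
half< x k x< = m<n*o⇒m/o<n (subst (x <_) (*-comm 2 (2 ^ k)) x<)

fromBase2-bits : ∀ k u → u < 2 ^ k → fromBase2 (applyUpTo (toℕ ∘ bit u) k) ≡ u
fromBase2-bits zero    zero    _           = refl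
fromBase2-bits zero    (suc u) (s≤s ())
fromBase2-bits (suc k) u       u< =
  trans (cong (λ r → toℕ (bit u 0) + 2 * r) (fromBase2-bits k (u / 2) (half< u k u<))) (bit0-split u)

matches : ℕ → ℕ → List Bool → Bool
matches x k []       = true
matches x k (b ∷ bs) = eqb b (bit x k) ∧ matches x (suc k) bs

matches-shift : ∀ x k bs → matches x (suc k) bs ≡ matches (x / 2) k bs
matches-shift x k []       = refl
matches-shift x k (b ∷ bs) = cong (eqb b (bit (x / 2) k) ∧_) (matches-shift x (suc k) bs)

matches-fromBits : ∀ bs → matches (fromBits bs) 0 bs ≡ true
matches-fromBits []       = refl
matches-fromBits (b ∷ bs) = begin
  eqb b (bit x 0) ∧ matches x 1 bs
    ≡⟨ cong₂ _∧_ (cong (eqb b) (bit0-cons b (fromBits bs)))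
                 (trans (matches-shift x 0 bs) (cong (λ y → matches y 0 bs) (half-cons b (fromBits bs)))) ⟩
  eqb b b ∧ matches (fromBits bs) 0 bs
    ≡⟨ cong₂ _∧_ (from (eqb≡true⇔ b b) refl) (matches-fromBits bs) ⟩
  true ∎
  where
  open ≡-Reasoning
  x = fromBits (b ∷ bs)

matches⇒fromBits : ∀ {x} bs → x < 2 ^ length bs → matches x 0 bs ≡ true → fromBits bs ≡ x
matches⇒fromBits {zero}  []       _        _ = refl
matches⇒fromBits {suc x} []       (s≤s ()) _
matches⇒fromBits {x}     (b ∷ bs) x<       m =
  let (head , tail) = to (∧≡true⇔ _ _) m
      b≡bit = to (eqb≡true⇔ b (bit x 0)) head
      ih = matches⇒fromBits bs (half< x (length bs) x<) (trans (sym (matches-shift x 0 bs)) tail)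
  in trans (cong₂ (λ c r → toℕ c + 2 * r) b≡bit ih) (bit0-split x)

matches⇔ : ∀ x bs → x < 2 ^ length bs → matches x 0 bs ≡ true ⇔ fromBits bs ≡ x
matches⇔ x bs x< = mk⇔ (matches⇒fromBits bs x<) (λ { refl → matches-fromBits bs })

srcValue : Assignment → Src → Bool
srcValue σ nothing  = false
srcValue σ (just w) = σ w

value : Assignment → List Src → ℕ
value σ ss = fromBits (map (srcValue σ) ss)

SrcBelow : ℕ → Src → Set
SrcBelow n = Maybe.All (_< n)

SrcBelow-mono : ∀ {n n′} → n ≤ n′ → ∀ {s} → SrcBelow n s → SrcBelow n′ s
SrcBelow-mono n≤n′ = Maybe.map (λ w<n → <-≤-trans w<n n≤n′)

SrcsBelow-mono : ∀ {n n′} → n ≤ n′ → ∀ {ss} → All (SrcBelow n) ss → All (SrcBelow n′) ss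
SrcsBelow-mono n≤n′ = All.map (SrcBelow-mono n≤n′)

value-wires : ∀ σ (w : ℕ → ℕ) xs →
              value σ (map (λ i → just (w i)) xs) ≡ fromBase2 (map (λ i → toℕ (σ (w i))) xs)
value-wires σ w []       = refl
value-wires σ w (x ∷ xs) = cong (λ r → toℕ (σ (w x)) + 2 * r) (value-wires σ w xs)

value-∷ʳ-nothing : ∀ σ ss → value σ (ss ++ nothing ∷ []) ≡ value σ ss
value-∷ʳ-nothing σ []       = refl
value-∷ʳ-nothing σ (s ∷ ss) = cong (λ r → toℕ (srcValue σ s) + 2 * r) (value-∷ʳ-nothing σ ss)

mkGate-consistent : ∀ σ {z} ss f → σ z ≡ evalGate σ (mkGate ss f) → σ z ≡ f (map (srcValue σ) ss)
mkGate-consistent σ {z} ss f e = begin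
  σ z
    ≡⟨ e ⟩
  f (fill ss (toList (Vec.map σ (fromList (wiresOf ss)))))
    ≡⟨ cong (f ∘ fill ss) (trans (Vec.toList-map σ (fromList _)) (cong (map σ) (Vec.toList∘fromList _))) ⟩
  f (fill ss (map σ (wiresOf ss)))
    ≡⟨ cong f (fill-wires ss) ⟩
  f (map (srcValue σ) ss) ∎
  where
  open ≡-Reasoning
  fill-wires : ∀ ss → fill ss (map σ (wiresOf ss)) ≡ map (srcValue σ) ss
  fill-wires []             = refl
  fill-wires (nothing ∷ ss) = cong (false ∷_) (fill-wires ss)
  fill-wires (just w ∷ ss)  = cong (σ w ∷_) (fill-wires ss)

wiresOf-length≤ : ∀ ss → length (wiresOf ss) ≤ length ss
wiresOf-length≤ []             = z≤n
wiresOf-length≤ (nothing ∷ ss) = m≤n⇒m≤1+n (wiresOf-length≤ ss)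
wiresOf-length≤ (just _ ∷ ss)  = s≤s (wiresOf-length≤ ss)

wiresOf-below : ∀ {n} ss → All (SrcBelow n) ss → VA.All (_< n) (fromList (wiresOf ss))
wiresOf-below []             []                    = VA.[]
wiresOf-below (nothing ∷ ss) (_ ∷ ss<)             = wiresOf-below ss ss<
wiresOf-below (just w ∷ ss)  (Maybe.just w< ∷ ss<) = w< VA.∷ wiresOf-below ss ss<

-- The ripple-carry adder

fullAdder : ∀ a b c →
  toℕ (xor3 (a ∷ b ∷ c ∷ [])) + 2 * toℕ (maj3 (a ∷ b ∷ c ∷ [])) ≡ toℕ a + toℕ b + toℕ c
fullAdder false false false = refl
fullAdder false false true  = refl
fullAdder false true  false = refl
fullAdder false true  true  = refl
fullAdder true  false false = refl
fullAdder true  false true  = refl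
fullAdder true  true  false = refl
fullAdder true  true  true  = refl

ripple-gates-length : ∀ n c ps → length (proj₁ (ripple n c ps)) ≡ 2 * length ps
ripple-gates-length n c []       = refl
ripple-gates-length n c (p ∷ ps) =
  trans (cong (2 +_) (ripple-gates-length (suc (suc n)) (just (suc n)) ps))
        (sym (*-suc 2 (length ps)))

ripple-outputs-length : ∀ n c ps → length (proj₂ (ripple n c ps)) ≡ suc (length ps)
ripple-outputs-length n c []       = refl
ripple-outputs-length n c (p ∷ ps) = cong suc (ripple-outputs-length (suc (suc n)) (just (suc n)) ps)

ripple-fanIn : ∀ n c ps → FanIn≤ 3 (proj₁ (ripple n c ps))
ripple-fanIn n c []       = []
ripple-fanIn n c ((a , b) ∷ ps) =
  wiresOf-length≤ (a ∷ b ∷ c ∷ []) ∷ wiresOf-length≤ (a ∷ b ∷ c ∷ [])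
  ∷ ripple-fanIn (suc (suc n)) (just (suc n)) ps

ripple-readsEarlier : ∀ n c as bs → SrcBelow n c → All (SrcBelow n) as → All (SrcBelow n) bs →
  let (gs , outs) = ripple n c (zip as bs) in ReadsEarlier n gs × All (SrcBelow (n + length gs)) outs
ripple-readsEarlier n c []       bs       c< _ _ = tt , SrcBelow-mono (m≤m+n n 0) c< ∷ []
ripple-readsEarlier n c (a ∷ as) []       c< _ _ = tt , SrcBelow-mono (m≤m+n n 0) c< ∷ []
ripple-readsEarlier n c (a ∷ as) (b ∷ bs) c< (a< ∷ as<) (b< ∷ bs<) =
    (wiresOf-below (a ∷ b ∷ c ∷ []) abc< , wiresOf-below (a ∷ b ∷ c ∷ []) (SrcsBelow-mono (n≤1+n n) abc<)
     , proj₁ rest)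
  , Maybe.just (m<m+n n z<s) ∷ SrcsBelow-mono (≤-reflexive (sym (trans (+-suc n _) (cong suc (+-suc n _)))))
                                              (proj₂ rest)
  where
  abc< = a< ∷ b< ∷ c< ∷ []
  n≤2+n = m≤n⇒m≤1+n (n≤1+n n)
  rest = ripple-readsEarlier (suc (suc n)) (just (suc n)) as bs (Maybe.just ≤-refl)
           (SrcsBelow-mono n≤2+n as<) (SrcsBelow-mono n≤2+n bs<)

ripple-value : ∀ σ n c as bs → length as ≡ length bs →
  let (gs , outs) = ripple n c (zip as bs)
  in Consistent σ n gs → value σ outs ≡ toℕ (srcValue σ c) + value σ as + value σ bs
ripple-value σ n c []       []       _  _ = sym (+-identityʳ _)
ripple-value σ n c (a ∷ as) (b ∷ bs) eq (sum≡ , carry≡ , c′) = begin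
    toℕ (σ n) + 2 * value σ outs
  ≡⟨ cong₂ (λ s r → toℕ s + 2 * r) (mkGate-consistent σ (a ∷ b ∷ c ∷ []) xor3 sum≡)
           (ripple-value σ (suc (suc n)) (just (suc n)) as bs (suc-injective eq) c′) ⟩
    toℕ S + 2 * (toℕ (σ (suc n)) + P + Q)
  ≡⟨ cong (λ m → toℕ S + 2 * (toℕ m + P + Q)) (mkGate-consistent σ (a ∷ b ∷ c ∷ []) maj3 carry≡) ⟩
    toℕ S + 2 * (toℕ M + P + Q)
  ≡⟨ solve 4 (λ s m p q → s :+ con 2 :* (m :+ p :+ q)
                       := (s :+ con 2 :* m) :+ con 2 :* p :+ con 2 :* q)
           refl (toℕ S) (toℕ M) P Q ⟩
    toℕ S + 2 * toℕ M + 2 * P + 2 * Q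
  ≡⟨ cong (λ t → t + 2 * P + 2 * Q) (fullAdder A B C) ⟩
    toℕ A + toℕ B + toℕ C + 2 * P + 2 * Q
  ≡⟨ solve 5 (λ a b c p q → a :+ b :+ c :+ con 2 :* p :+ con 2 :* q
                           := c :+ (a :+ con 2 :* p) :+ (b :+ con 2 :* q))
           refl (toℕ A) (toℕ B) (toℕ C) P Q ⟩
    toℕ C + (toℕ A + 2 * P) + (toℕ B + 2 * Q)
  ∎
  where
  open ≡-Reasoning
  outs = proj₂ (ripple (suc (suc n)) (just (suc n)) (zip as bs))
  A = srcValue σ a
  B = srcValue σ b
  C = srcValue σ c
  S = xor3 (A ∷ B ∷ C ∷ [])
  M = maj3 (A ∷ B ∷ C ∷ [])
  P = value σ as
  Q = value σ bs

-- Schoolbook accumulation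

row-length : ∀ ℓ j → length (row ℓ j) ≡ ℓ
row-length ℓ j = trans (List.length-map _ (upTo ℓ)) (List.length-upTo ℓ)

zip-row-length : ∀ ℓ j (up : List Src) → length up ≡ ℓ → length (zip up (row ℓ j)) ≡ ℓ
zip-row-length ℓ j up up≡ = trans (List.length-zipWith _,_ up (row ℓ j))
  (trans (cong₂ _⊓_ up≡ (row-length ℓ j)) (⊓-idem ℓ))

addRow-gates-length : ∀ ℓ n j (up : List Src) → length up ≡ ℓ →
                      length (proj₁ (ripple n nothing (zip up (row ℓ j)))) ≡ 2 * ℓ
addRow-gates-length ℓ n j up up≡ =
  trans (ripple-gates-length n nothing (zip up (row ℓ j))) (cong (2 *_) (zip-row-length ℓ j up up≡))

addRow-outputs-length : ∀ ℓ n j (up : List Src) → length up ≡ ℓ →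
                        length (proj₂ (ripple n nothing (zip up (row ℓ j)))) ≡ suc ℓ
addRow-outputs-length ℓ n j up up≡ =
  trans (ripple-outputs-length n nothing (zip up (row ℓ j))) (cong suc (zip-row-length ℓ j up up≡))

steps-gates-length : ∀ ℓ n js acc → length acc ≡ suc ℓ →
                     length (proj₁ (steps ℓ n js acc)) ≡ length js * (2 * ℓ)
steps-gates-length ℓ n []       acc        _  = refl
steps-gates-length ℓ n (j ∷ js) (a₀ ∷ up) eq =
  trans (List.length-++ (proj₁ R))
        (cong₂ _+_ (addRow-gates-length ℓ n j up (suc-injective eq))
                   (steps-gates-length ℓ (n + length (proj₁ R)) js (proj₂ R)
                      (addRow-outputs-length ℓ n j up (suc-injective eq))))
  where R = ripple n nothing (zip up (row ℓ j))

steps-outputs-length : ∀ ℓ n js acc → length acc ≡ suc ℓ →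
                       length (proj₂ (steps ℓ n js acc)) ≡ length js + suc ℓ
steps-outputs-length ℓ n []       acc        eq = eq
steps-outputs-length ℓ n (j ∷ js) (a₀ ∷ up) eq =
  cong suc (steps-outputs-length ℓ _ js _ (addRow-outputs-length ℓ n j up (suc-injective eq)))

steps-fanIn : ∀ ℓ n js acc → FanIn≤ 3 (proj₁ (steps ℓ n js acc))
steps-fanIn ℓ n []       acc        = []
steps-fanIn ℓ n (j ∷ js) []         = []
steps-fanIn ℓ n (j ∷ js) (a₀ ∷ up) =
  ++⁺ (ripple-fanIn n nothing (zip up (row ℓ j))) (steps-fanIn ℓ _ js _)

steps-readsEarlier : ∀ ℓ n js acc →
  All (SrcBelow n) acc → All (λ j → All (SrcBelow n) (row ℓ j)) js →
  let (gs , outs) = steps ℓ n js acc in ReadsEarlier n gs × All (SrcBelow (n + length gs)) outs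
steps-readsEarlier ℓ n []       acc        acc< _ = tt , SrcsBelow-mono (m≤m+n n 0) acc<
steps-readsEarlier ℓ n (j ∷ js) []         _    _ = tt , []
steps-readsEarlier ℓ n (j ∷ js) (a₀ ∷ up) (a₀< ∷ up<) (row< ∷ rows<) =
    ReadsEarlier-++ (proj₁ R) refl (proj₁ R<) (proj₁ T<)
  , SrcBelow-mono (m≤m+n n _) a₀< ∷ SrcsBelow-mono (≤-reflexive offset) (proj₂ T<)
  where
  R = ripple n nothing (zip up (row ℓ j))
  n₁ = n + length (proj₁ R)
  R< = ripple-readsEarlier n nothing up (row ℓ j) Maybe.nothing up< row<
  T = steps ℓ n₁ js (proj₂ R)
  T< = steps-readsEarlier ℓ n₁ js (proj₂ R) (proj₂ R<)
         (All.map (SrcsBelow-mono (m≤m+n n _)) rows<)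
  offset : n₁ + length (proj₁ T) ≡ n + length (proj₁ R ++ proj₁ T)
  offset = trans (+-assoc n _ _) (cong (n +_) (sym (List.length-++ (proj₁ R))))

steps-value : ∀ σ ℓ n js acc → length acc ≡ suc ℓ → Consistent σ n (proj₁ (steps ℓ n js acc)) →
  value σ (proj₂ (steps ℓ n js acc))
    ≡ value σ acc + 2 * fromBase2 (map (λ j → value σ (row ℓ j)) js)
steps-value σ ℓ n []       acc        _  _ = sym (+-identityʳ _)
steps-value σ ℓ n (j ∷ js) (a₀ ∷ up) eq c = begin
    toℕ (srcValue σ a₀) + 2 * value σ (proj₂ T)
  ≡⟨ cong (λ r → toℕ (srcValue σ a₀) + 2 * r)
          (trans (steps-value σ ℓ (n + length (proj₁ R)) js (proj₂ R)
                              (addRow-outputs-length ℓ n j up (suc-injective eq)) (proj₂ c′))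
                 (cong (_+ 2 * Rows) (ripple-value σ n nothing up (row ℓ j) up≡row (proj₁ c′)))) ⟩
    toℕ (srcValue σ a₀) + 2 * (value σ up + value σ (row ℓ j) + 2 * Rows)
  ≡⟨ solve 4 (λ a u w r → a :+ con 2 :* (u :+ w :+ con 2 :* r)
                       := a :+ con 2 :* u :+ con 2 :* (w :+ con 2 :* r))
           refl (toℕ (srcValue σ a₀)) (value σ up) (value σ (row ℓ j)) Rows ⟩
    toℕ (srcValue σ a₀) + 2 * value σ up + 2 * (value σ (row ℓ j) + 2 * Rows)
  ∎
  where
  open ≡-Reasoning
  R = ripple n nothing (zip up (row ℓ j))
  T = steps ℓ (n + length (proj₁ R)) js (proj₂ R)
  Rows = fromBase2 (map (λ j → value σ (row ℓ j)) js)
  up≡row = trans (suc-injective eq) (sym (row-length ℓ j))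
  c′ = Consistent-++ σ (proj₁ R) refl c

andRow : ℕ → ℕ → List Gate
andRow ℓ j = map (λ i → andGate i (ℓ + j)) (upTo ℓ)

andRow-length : ∀ ℓ j → length (andRow ℓ j) ≡ ℓ
andRow-length ℓ j = trans (List.length-map _ (upTo ℓ)) (List.length-upTo ℓ)

andGates-length : ∀ ℓ → length (andGates ℓ) ≡ ℓ * ℓ
andGates-length ℓ =
  trans (length-concatMap (andRow-length ℓ) (upTo ℓ)) (cong (_* ℓ) (List.length-upTo ℓ))

andGates-fanIn : ∀ ℓ → FanIn≤ 2 (andGates ℓ)
andGates-fanIn ℓ =
  concat⁺ (map⁺ (All.universal (λ j → map⁺ (All.universal (λ _ → ≤-refl) (upTo ℓ))) (upTo ℓ)))

andGates-readsEarlier : ∀ ℓ → ReadsEarlier (2 * ℓ) (andGates ℓ)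
andGates-readsEarlier ℓ = ReadsEarlier-below (andGates ℓ) ≤-refl
  (concat⁺ (map⁺ (applyUpTo⁺₁ id ℓ λ j<ℓ → map⁺ (applyUpTo⁺₁ id ℓ λ i<ℓ →
     <-≤-trans i<ℓ (m≤m+n ℓ _) VA.∷ +-monoʳ-< ℓ (<-≤-trans j<ℓ ℓ≤ℓ+0) VA.∷ VA.[]))))
  where ℓ≤ℓ+0 = ≤-reflexive (sym (+-identityʳ ℓ))

andGates-output : ∀ σ ℓ → Consistent σ (2 * ℓ) (andGates ℓ) →
                  ∀ {i j} → i < ℓ → j < ℓ → σ (2 * ℓ + ℓ * j + i) ≡ (σ i ∧ σ (ℓ + j))
andGates-output σ ℓ c {i} {j} i<ℓ j<ℓ =
  Consistent-map σ (λ i → andGate i (ℓ + j)) id ℓ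
    (Consistent-concatMap σ (andRow ℓ) (andRow-length ℓ) id ℓ c j<ℓ) i<ℓ

row-wire< : ∀ {ℓ i j} → i < ℓ → j < ℓ → 2 * ℓ + ℓ * j + i < 2 * ℓ + ℓ * ℓ
row-wire< {ℓ} {i} {j} i<ℓ j<ℓ = begin-strict
  2 * ℓ + ℓ * j + i    ≡⟨ +-assoc (2 * ℓ) (ℓ * j) i ⟩
  2 * ℓ + (ℓ * j + i)  <⟨ +-monoʳ-< (2 * ℓ) (+-monoʳ-< (ℓ * j) i<ℓ) ⟩
  2 * ℓ + (ℓ * j + ℓ)  ≡⟨ cong (2 * ℓ +_) (trans (+-comm (ℓ * j) ℓ) (sym (*-suc ℓ j))) ⟩
  2 * ℓ + ℓ * suc j    ≤⟨ +-monoʳ-≤ (2 * ℓ) (*-monoʳ-≤ ℓ j<ℓ) ⟩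
  2 * ℓ + ℓ * ℓ        ∎
  where open ≤-Reasoning

row-below : ∀ ℓ {j} → j < ℓ → All (SrcBelow (2 * ℓ + ℓ * ℓ)) (row ℓ j)
row-below ℓ j<ℓ = map⁺ (applyUpTo⁺₁ id ℓ λ i<ℓ → Maybe.just (row-wire< i<ℓ j<ℓ))

chain-length : ∀ x p k ss → length (chain x p k ss) ≡ length ss
chain-length x p k []       = refl
chain-length x p k (s ∷ ss) = cong suc (chain-length x (suc p) (suc k) ss)

chain-fanIn : ∀ x p k ss → FanIn≤ 2 (chain x p k ss)
chain-fanIn x p k []       = []
chain-fanIn x p k (s ∷ ss) = wiresOf-length≤ (just p ∷ s ∷ []) ∷ chain-fanIn x (suc p) (suc k) ss

chain-readsEarlier : ∀ x p k ss → All (SrcBelow (suc p)) ss → ReadsEarlier (suc p) (chain x p k ss)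
chain-readsEarlier x p k []       _          = tt
chain-readsEarlier x p k (s ∷ ss) (s< ∷ ss<) =
  wiresOf-below (just p ∷ s ∷ []) (Maybe.just ≤-refl ∷ s< ∷ [])
  , chain-readsEarlier x (suc p) (suc k) ss (SrcsBelow-mono (n≤1+n _) ss<)

-- Splitting on the sources lets the gate functions, anonymous pattern-matching lambdas, compute.
chain-gate : ∀ σ x p k s {ss} → Consistent σ (suc p) (chain x p k (s ∷ ss)) →
             σ (suc p) ≡ (σ p ∧ eqb (srcValue σ s) (bit x k))
chain-gate σ x p k nothing  (e , _) = e
chain-gate σ x p k (just _) (e , _) = e

check-gate : ∀ σ n x s₀ s₁ rest → Consistent σ n (check n x (s₀ ∷ s₁ ∷ rest)) →
             σ n ≡ (eqb (srcValue σ s₀) (bit x 0) ∧ eqb (srcValue σ s₁) (bit x 1))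
check-gate σ n x nothing  nothing  rest (e , _) = e
check-gate σ n x nothing  (just _) rest (e , _) = e
check-gate σ n x (just _) nothing  rest (e , _) = e
check-gate σ n x (just _) (just _) rest (e , _) = e

chain-output : ∀ σ x p k ss → Consistent σ (suc p) (chain x p k ss) →
               σ (p + length ss) ≡ (σ p ∧ matches x k (map (srcValue σ) ss))
chain-output σ x p k []       _       = trans (cong σ (+-identityʳ p)) (sym (∧-identityʳ (σ p)))
chain-output σ x p k (s ∷ ss) (e , c) = begin
  σ (p + suc (length ss))                       ≡⟨ cong σ (+-suc p (length ss)) ⟩
  σ (suc p + length ss)                         ≡⟨ chain-output σ x (suc p) (suc k) ss c ⟩
  σ (suc p) ∧ M                                 ≡⟨ cong (_∧ M) (chain-gate σ x p k s (e , c)) ⟩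
  (σ p ∧ eqb (srcValue σ s) (bit x k)) ∧ M      ≡⟨ ∧-assoc (σ p) _ M ⟩
  σ p ∧ matches x k (map (srcValue σ) (s ∷ ss)) ∎
  where
  open ≡-Reasoning
  M = matches x (suc k) (map (srcValue σ) ss)

check-length : ∀ n x bits {r} → length bits ≡ suc (suc r) → length (check n x bits) ≡ suc r
check-length n x (s₀ ∷ s₁ ∷ rest) eq =
  cong suc (trans (chain-length x n 2 rest) (suc-injective (suc-injective eq)))

check-fanIn : ∀ n x bits → FanIn≤ 2 (check n x bits)
check-fanIn n x []               = []
check-fanIn n x (_ ∷ [])         = []
check-fanIn n x (s₀ ∷ s₁ ∷ rest) = wiresOf-length≤ (s₀ ∷ s₁ ∷ []) ∷ chain-fanIn x n 2 rest

check-readsEarlier : ∀ n x bits → All (SrcBelow n) bits → ReadsEarlier n (check n x bits)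
check-readsEarlier n x []               _ = tt
check-readsEarlier n x (_ ∷ [])         _ = tt
check-readsEarlier n x (s₀ ∷ s₁ ∷ rest) (s₀< ∷ s₁< ∷ rest<) =
  wiresOf-below (s₀ ∷ s₁ ∷ []) (s₀< ∷ s₁< ∷ [])
  , chain-readsEarlier x n 2 rest (SrcsBelow-mono (n≤1+n n) rest<)

check-accepts⇔ : ∀ σ n x bits → 2 ≤ length bits → Consistent σ n (check n x bits) →
                 OutputTrue σ n (check n x bits) ⇔ matches x 0 (map (srcValue σ) bits) ≡ true
check-accepts⇔ σ n x []               ()
check-accepts⇔ σ n x (_ ∷ [])         (s≤s ())
check-accepts⇔ σ n x (s₀ ∷ s₁ ∷ rest) _ (e , c) =
  ⇔.trans (OutputTrue-last σ _ (chain x n 2 rest) (cong (n +_) (chain-length x n 2 rest)))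
          (≡⇒⇔ (_≡ true) output≡)
  where
  open ≡-Reasoning
  E₀ = eqb (srcValue σ s₀) (bit x 0)
  E₁ = eqb (srcValue σ s₁) (bit x 1)
  M  = matches x 2 (map (srcValue σ) rest)
  output≡ : σ (n + length rest) ≡ matches x 0 (map (srcValue σ) (s₀ ∷ s₁ ∷ rest))
  output≡ = begin
    σ (n + length rest)  ≡⟨ chain-output σ x n 2 rest c ⟩
    σ n ∧ M              ≡⟨ cong (_∧ M) (check-gate σ n x s₀ s₁ rest (e , c)) ⟩
    (E₀ ∧ E₁) ∧ M        ≡⟨ ∧-assoc E₀ E₁ M ⟩
    E₀ ∧ E₁ ∧ M          ∎

-- The test circuit

Encodes-local : ∀ ℓ {σ τ u v} → Agree (2 * ℓ) σ τ → Encodes ℓ σ u v → Encodes ℓ τ u v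
Encodes-local ℓ agree (low , high) =
    (λ i i<ℓ → trans (sym (agree (<-≤-trans i<ℓ (m≤m+n ℓ _)))) (low i i<ℓ))
  , (λ i i<ℓ → trans (sym (agree (+-monoʳ-< ℓ (<-≤-trans i<ℓ ℓ≤ℓ+0)))) (high i i<ℓ))
  where ℓ≤ℓ+0 = ≤-reflexive (sym (+-identityʳ ℓ))

inputs : ℕ → ℕ → ℕ → Assignment
inputs ℓ u v w with w <? ℓ
... | yes _ = bit u w
... | no  _ = bit v (w ∸ ℓ)

inputs-encodes : ∀ ℓ u v → Encodes ℓ (inputs ℓ u v) u v
inputs-encodes ℓ u v = low , high
  where
  low : ∀ i → i < ℓ → inputs ℓ u v i ≡ bit u i
  low i i<ℓ with i <? ℓ
  ... | yes _   = refl
  ... | no  i≮ℓ = contradiction i<ℓ i≮ℓ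
  high : ∀ i → i < ℓ → inputs ℓ u v (ℓ + i) ≡ bit v i
  high i _ with ℓ + i <? ℓ
  ... | yes ℓ+i<ℓ = contradiction ℓ+i<ℓ (m+n≮m ℓ i)
  ... | no  _     = cong (bit v) (m+n∸m≡n ℓ i)

product-bound : ∀ ℓ {p q} → p < 2 ^ ℓ → q < 2 ^ ℓ → p * q < 2 ^ (2 * ℓ)
product-bound ℓ p< q< = <-≤-trans (*-mono-< p< q<) (≤-reflexive (sym (begin
  2 ^ (2 * ℓ)      ≡⟨ cong (λ k → 2 ^ (ℓ + k)) (+-identityʳ ℓ) ⟩
  2 ^ (ℓ + ℓ)      ≡⟨ ^-distribˡ-+-* 2 ℓ ℓ ⟩
  2 ^ ℓ * 2 ^ ℓ    ∎)))
  where open ≡-Reasoning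

-- gates (testCircuit ℓ x) unfolds definitionally to andGates ℓ ++ adderGates ++ checkGates x.
module TestCircuit (m : ℕ) where

  ℓ n₀ : ℕ
  ℓ  = suc m
  n₀ = 2 * ℓ + ℓ * ℓ

  initial : List Src
  initial = row ℓ 0 ++ nothing ∷ []

  laterRows : List ℕ
  laterRows = map suc (upTo m)

  adderGates : List Gate
  adderGates = proj₁ (steps ℓ n₀ laterRows initial)

  productBits : List Src
  productBits = proj₂ (steps ℓ n₀ laterRows initial)

  checkGates : ℕ → List Gate
  checkGates x = check (n₀ + length adderGates) x productBits

  initial-length : length initial ≡ suc ℓ
  initial-length =
    trans (List.length-++ (row ℓ 0)) (trans (cong (_+ 1) (row-length ℓ 0)) (+-comm ℓ 1))

  laterRows-length : length laterRows ≡ m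
  laterRows-length = trans (List.length-map suc (upTo m)) (List.length-upTo m)

  adderGates-length : length adderGates ≡ m * (2 * ℓ)
  adderGates-length =
    trans (steps-gates-length ℓ n₀ laterRows initial initial-length) (cong (_* (2 * ℓ)) laterRows-length)

  productBits-length : length productBits ≡ 2 + 2 * m
  productBits-length =
    trans (steps-outputs-length ℓ n₀ laterRows initial initial-length)
          (trans (cong (_+ suc ℓ) laterRows-length)
                 (solve 1 (λ m → m :+ (con 2 :+ m) := con 2 :+ con 2 :* m) refl m))

  checkGates-length : ∀ x → length (checkGates x) ≡ suc (2 * m)
  checkGates-length x = check-length _ x productBits productBits-length

  gates-length : ∀ x → length (gates (testCircuit ℓ x)) ≡ ℓ * ℓ + (m * (2 * ℓ) + suc (2 * m))
  gates-length x =
    trans (List.length-++ (andGates ℓ))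
          (cong₂ _+_ (andGates-length ℓ)
                     (trans (List.length-++ adderGates) (cong₂ _+_ adderGates-length (checkGates-length x))))

  numVars-testCircuit : ∀ x → numVars (testCircuit ℓ x) ≡ 3 * ℓ ^ 2 + 2 * ℓ ∸ 1
  numVars-testCircuit x = trans (cong (2 * ℓ +_) (gates-length x)) (sym (cong (_∸ 1)
    (solve 1 (λ m → con 3 :* (con 1 :+ m) :^ 2 :+ con 2 :* (con 1 :+ m)
                 := con 1 :+ (con 2 :* (con 1 :+ m) :+ ((con 1 :+ m) :* (con 1 :+ m)
                                :+ (m :* (con 2 :* (con 1 :+ m)) :+ (con 1 :+ con 2 :* m)))))
             refl m)))

  readsEarlier : ∀ x → ReadsEarlier (2 * ℓ) (gates (testCircuit ℓ x))
  readsEarlier x =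
    ReadsEarlier-++ (andGates ℓ) (cong (2 * ℓ +_) (andGates-length ℓ)) (andGates-readsEarlier ℓ)
      (ReadsEarlier-++ adderGates refl (proj₁ schoolbook<)
                       (check-readsEarlier _ x productBits (proj₂ schoolbook<)))
    where
    schoolbook< = steps-readsEarlier ℓ n₀ laterRows initial
                    (++⁺ (row-below ℓ z<s) (Maybe.nothing ∷ []))
                    (map⁺ (applyUpTo⁺₁ id m λ j<m → row-below ℓ (s≤s j<m)))

  fanIn : ∀ x → FanIn≤ 3 (gates (testCircuit ℓ x))
  fanIn x = ++⁺ (FanIn-mono (n≤1+n 2) (andGates-fanIn ℓ))
                (++⁺ (steps-fanIn ℓ n₀ laterRows initial)
                     (FanIn-mono (n≤1+n 2) (check-fanIn _ x productBits)))

  clauseCount-testCircuit : ∀ x → clauseCount (gates (testCircuit ℓ x)) ≤ 20 * ℓ ^ 2 ∸ 8 * ℓ ∸ 4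
  clauseCount-testCircuit x = begin
    clauseCount (andGates ℓ ++ adderGates ++ checkGates x)
      ≡⟨ trans (clauseCount-++ (andGates ℓ) _)
               (cong (clauseCount (andGates ℓ) +_) (clauseCount-++ adderGates _)) ⟩
    clauseCount (andGates ℓ) + (clauseCount adderGates + clauseCount (checkGates x))
      ≤⟨ +-mono-≤ (clauseCount≤ _ (andGates-fanIn ℓ))
                  (+-mono-≤ (clauseCount≤ _ (steps-fanIn ℓ n₀ laterRows initial))
                            (clauseCount≤ _ (check-fanIn _ x productBits))) ⟩
    4 * length (andGates ℓ) + (8 * length adderGates + 4 * length (checkGates x))
      ≡⟨ cong₂ (λ a r → 4 * a + r) (andGates-length ℓ)
               (cong₂ (λ b c → 8 * b + 4 * c) adderGates-length (checkGates-length x)) ⟩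
    B
      ≡⟨ sym bound≡B ⟩
    20 * ℓ ^ 2 ∸ 8 * ℓ ∸ 4 ∎
    where
    open ≤-Reasoning
    B = 4 * (ℓ * ℓ) + (8 * (m * (2 * ℓ)) + 4 * suc (2 * m))
    bound≡B : 20 * ℓ ^ 2 ∸ 8 * ℓ ∸ 4 ≡ B
    bound≡B = trans (cong (λ t → t ∸ 8 * ℓ ∸ 4) (solve 1 (λ m → con 20 :* (con 1 :+ m) :^ 2
                      := con 4 :* ((con 1 :+ m) :* (con 1 :+ m))
                         :+ (con 8 :* (m :* (con 2 :* (con 1 :+ m))) :+ con 4 :* (con 1 :+ con 2 :* m))
                         :+ con 4 :+ con 8 :* (con 1 :+ m)) refl m))
              (trans (cong (_∸ 4) (m+n∸n≡m (B + 4) (8 * ℓ))) (m+n∸n≡m B 4))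

  consistent-blocks : ∀ {σ} x → Consistent σ (2 * ℓ) (gates (testCircuit ℓ x)) →
    Consistent σ (2 * ℓ) (andGates ℓ) × Consistent σ n₀ adderGates
    × Consistent σ (n₀ + length adderGates) (checkGates x)
  consistent-blocks {σ} x c =
    let (cAnd , c′) = Consistent-++ σ (andGates ℓ) (cong (2 * ℓ +_) (andGates-length ℓ)) c
    in cAnd , Consistent-++ σ adderGates refl c′

  row-value : ∀ {σ u v} → Encodes ℓ σ u v → u < 2 ^ ℓ → Consistent σ (2 * ℓ) (andGates ℓ) →
              ∀ {j} → j < ℓ → value σ (row ℓ j) ≡ u * toℕ (bit v j)
  row-value {σ} {u} {v} (low , high) u< c {j} j<ℓ = begin
    value σ (row ℓ j)
      ≡⟨ value-wires σ (λ i → 2 * ℓ + ℓ * j + i) (upTo ℓ) ⟩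
    fromBase2 (map (λ i → toℕ (σ (2 * ℓ + ℓ * j + i))) (upTo ℓ))
      ≡⟨ fromBase2-scale _ (toℕ ∘ bit u) vⱼ (upTo ℓ) (applyUpTo⁺₁ id ℓ partialProduct) ⟩
    vⱼ * fromBase2 (map (toℕ ∘ bit u) (upTo ℓ))
      ≡⟨ cong (λ ds → vⱼ * fromBase2 ds) (List.map-applyUpTo id (toℕ ∘ bit u) ℓ) ⟩
    vⱼ * fromBase2 (applyUpTo (toℕ ∘ bit u) ℓ)
      ≡⟨ cong (vⱼ *_) (fromBase2-bits ℓ u u<) ⟩
    vⱼ * u
      ≡⟨ *-comm vⱼ u ⟩
    u * vⱼ ∎
    where
    open ≡-Reasoning
    vⱼ = toℕ (bit v j)
    partialProduct : ∀ {i} → i < ℓ → toℕ (σ (2 * ℓ + ℓ * j + i)) ≡ vⱼ * toℕ (bit u i)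
    partialProduct {i} i<ℓ = begin
      toℕ (σ (2 * ℓ + ℓ * j + i))    ≡⟨ cong toℕ (andGates-output σ ℓ c i<ℓ j<ℓ) ⟩
      toℕ (σ i ∧ σ (ℓ + j))          ≡⟨ cong₂ (λ a b → toℕ (a ∧ b)) (low i i<ℓ) (high j j<ℓ) ⟩
      toℕ (bit u i ∧ bit v j)        ≡⟨ toℕ-∧ (bit u i) (bit v j) ⟩
      toℕ (bit u i) * vⱼ             ≡⟨ *-comm (toℕ (bit u i)) vⱼ ⟩
      vⱼ * toℕ (bit u i)             ∎

  product-value : ∀ {σ u v} x → Encodes ℓ σ u v → u < 2 ^ ℓ → v < 2 ^ ℓ →
                  Consistent σ (2 * ℓ) (gates (testCircuit ℓ x)) → value σ productBits ≡ u * v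
  product-value {σ} {u} {v} x enc u< v< c = begin
    value σ productBits
      ≡⟨ steps-value σ ℓ n₀ laterRows initial initial-length (proj₁ (proj₂ blocks)) ⟩
    value σ initial + 2 * fromBase2 (map rowValue laterRows)
      ≡⟨ cong₂ (λ a js → a + 2 * fromBase2 (map rowValue js))
               (value-∷ʳ-nothing σ (row ℓ 0)) (List.map-applyUpTo id suc m) ⟩
    fromBase2 (map rowValue (upTo ℓ))
      ≡⟨ fromBase2-scale rowValue (toℕ ∘ bit v) u (upTo ℓ)
                         (applyUpTo⁺₁ id ℓ (row-value enc u< (proj₁ blocks))) ⟩
    u * fromBase2 (map (toℕ ∘ bit v) (upTo ℓ))
      ≡⟨ cong (λ ds → u * fromBase2 ds) (List.map-applyUpTo id (toℕ ∘ bit v) ℓ) ⟩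
    u * fromBase2 (applyUpTo (toℕ ∘ bit v) ℓ)
      ≡⟨ cong (u *_) (fromBase2-bits ℓ v v<) ⟩
    u * v ∎
    where
    open ≡-Reasoning
    blocks = consistent-blocks x c
    rowValue : ℕ → ℕ
    rowValue j = value σ (row ℓ j)

  accepts⇔ : ∀ {σ u v} x → x < 2 ^ (2 * ℓ) → Encodes ℓ σ u v → u < 2 ^ ℓ → v < 2 ^ ℓ →
             Consistent σ (2 * ℓ) (gates (testCircuit ℓ x)) →
             OutputTrue σ (2 * ℓ) (gates (testCircuit ℓ x)) ⇔ u * v ≡ x
  accepts⇔ {σ} {u} {v} x x< enc u< v< c = begin
    OutputTrue σ (2 * ℓ) (andGates ℓ ++ adderGates ++ checkGates x)
      ∼⟨ OutputTrue-++ σ (andGates ℓ)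
                       (<-≤-trans checks≢[] (List.length-++-≤ʳ (checkGates x) {adderGates}))
                       (cong (2 * ℓ +_) (andGates-length ℓ)) ⟩
    OutputTrue σ n₀ (adderGates ++ checkGates x)
      ∼⟨ OutputTrue-++ σ adderGates checks≢[] refl ⟩
    OutputTrue σ (n₀ + length adderGates) (checkGates x)
      ∼⟨ check-accepts⇔ σ _ x productBits (subst (2 ≤_) (sym productBits-length) (m≤m+n 2 (2 * m)))
                        (proj₂ (proj₂ (consistent-blocks x c))) ⟩
    matches x 0 (map (srcValue σ) productBits) ≡ true
      ∼⟨ matches⇔ x (map (srcValue σ) productBits) (subst (λ k → x < 2 ^ k) (sym length≡) x<) ⟩
    value σ productBits ≡ x
      ∼⟨ ≡⇒⇔ (_≡ x) (product-value x enc u< v< c) ⟩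
    u * v ≡ x ∎
    where
    open Related.EquationalReasoning
    checks≢[] : 0 < length (checkGates x)
    checks≢[] = subst (0 <_) (sym (checkGates-length x)) z<s
    length≡ : length (map (srcValue σ) productBits) ≡ 2 * ℓ
    length≡ = trans (List.length-map (srcValue σ) productBits) (trans productBits-length (sym (*-suc 2 m)))

mainTheorem9 : (ℓ x : ℕ) → 1 ≤ ℓ →
  (∃₂ λ p q → BitPrime ℓ p × BitPrime ℓ q × x ≡ p * q) →
  let C = testCircuit ℓ x
      E = toExt C
      N = toCNF C
      nv = numVars C
  in  (nv ≡ 3 * ℓ ^ 2 + 2 * ℓ ∸ 1)
    × (length E ≤ nv)
    × All (λ c → (carity c ≤ 4) × VA.All (_< nv) (cvars c)) E
    × (length N ≤ 20 * ℓ ^ 2 ∸ 8 * ℓ ∸ 4)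
    × All (λ cl → (length cl ≤ 4) × All (λ lit → proj₁ lit < nv) cl) N
    × (2 * ℓ ≤ nv)
    × ((u v : ℕ) → u < 2 ^ ℓ → v < 2 ^ ℓ →
         ((∃ λ σ → Encodes ℓ σ u v × SatExt σ E) ⇔ (u * v ≡ x))
       × ((∃ λ σ → Encodes ℓ σ u v × SatCNF σ N) ⇔ (u * v ≡ x)))
mainTheorem9 (suc m) x _ (p , q , (_ , _ , p<) , (_ , _ , q<) , refl) =
    numVars-testCircuit x
  , length-toExt≤numVars C
  , toExt-within C (readsEarlier x) (fanIn x)
  , ≤-trans (≤-reflexive (length-gatesCNF (2 * ℓ) (gates C))) (clauseCount-testCircuit x)
  , toCNF-within C (readsEarlier x) (fanIn x)
  , m≤m+n (2 * ℓ) (length (gates C))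
  , λ u v u< v< → reduction-faithful C (λ σ → Encodes ℓ σ u v) (readsEarlier x) (Encodes-local ℓ)
                    (inputs ℓ u v , inputs-encodes ℓ u v)
                    (λ σ enc c → accepts⇔ x (product-bound ℓ p< q<) enc u< v< c)
  where
  open TestCircuit m
  C = testCircuit ℓ x
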